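{- Let $s$ be a positive integer and $r$ a non-negative integer, and let $\underline{\lambda}=(\lambda_1\geq\cdots\geq\lambda_s)$ be a sequence of $s$ non-negative integers with $\sum_i\lambda_i=r$. Write $\underline{\lambda}=(\mu_1^{\rho_1}>\mu_2^{\rho_2}>\cdots>\mu_l^{\rho_l})$, meaning that $\mu_1>\mu_2>\cdots>\mu_l$ are the distinct entries of $\underline{\lambda}$ and $\mu_i$ occurs with multiplicity $\rho_i$ (so $\sum_i\mu_i\rho_i=r$ and $\sum_i\rho_i=s$). Let $t$ be any positive integer and let $\underline{\lambda}'=(\lambda_1'\geq\lambda_2'\geq\cdots\geq\lambda'_{\lambda_1+t})$ be the conjugate partition of $\underline{\lambda}+t=(\lambda_1+t\geq\cdots\geq\lambda_s+t)$ (so $\lambda_1'=s$), with the convention $\lambda_j'=0$ for $j>\lambda_1+t$. Then $$\sum_{1\le i<j\le l}(\mu_i-\mu_j-1)\rho_i\rho_j=\sum_{j\geq 1}(\lambda_1'-\lambda_j')\lambda_{j+1}'.$$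
   Context: For a partition $\underline{\nu}=(\nu_1\geq\cdots\geq\nu_k)$ with positive parts, its conjugate is $\underline{\nu}'=(\nu_1'\geq\cdots\geq\nu'_{\nu_1})$ where $\nu_i'=\#\{j:\nu_j\geq i\}$ for $1\le i\le\nu_1$. -}

module Defs where

open import Data.Nat using (ℕ; zero; suc; _+_; _*_; _∸_; _≤?_; _<?_)
open import Data.Fin using (Fin; toℕ)
open import Data.List using (List; []; _∷_; length; filter; tabulate; map; upTo)
open import Data.Nat.ListAction using (sum)
open import Data.Bool using (if_then_else_)
open import Relation.Nullary.Decidable using (⌊_⌋)

Σ[_]_ : (n : ℕ) → (Fin n → ℕ) → ℕ
Σ[ n ] f = sum (tabulate f)

-- Sum over pairs 1 ≤ i < j ≤ l (0-based indices in Fin l).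
Σpairs : (l : ℕ) → (Fin l → Fin l → ℕ) → ℕ
Σpairs l f = Σ[ l ] (λ i → Σ[ l ] (λ j → if ⌊ toℕ i <? toℕ j ⌋ then f i j else 0))

Σ1to : ℕ → (ℕ → ℕ) → ℕ
Σ1to n f = sum (map (λ k → f (suc k)) (upTo n))

head0 : List ℕ → ℕ
head0 [] = 0
head0 (x ∷ _) = x

-- Conjugate partition, as a function of the index j ≥ 1:
-- ν'_j = #{ i : ν_i ≥ j }; this is automatically 0 for j > ν_1.
conj : List ℕ → ℕ → ℕ
conj ν j = length (filter (λ x → j ≤? x) ν)

-- Both sides equal the sum, over ordered pairs (a, b) of entries of λ, of
-- max(a − b − 1, 0). On the left this is that sum grouped by the distinct
-- values μᵢ with multiplicities ρᵢ. On the right, λ'ⱼ = s for j ≤ t, so only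
-- the indices j = t + k + 1 (k ≥ 0) contribute; there s − λ'ⱼ counts the
-- entries b ≤ k and λ'ⱼ₊₁ the entries a ≥ k + 2, and summing over k counts,
-- for each pair (a, b), the k with b ≤ k ≤ a − 2.
module Submission where

open import Defs
open import Data.Nat using (ℕ; zero; suc; _+_; _*_; _∸_; _≤_; _<_; _≥_; z≤n; s≤s; z<s; _≤?_; _<?_)
open import Data.Nat.Properties
open import Data.Nat.ListAction using (sum)
open import Data.Nat.ListAction.Properties using (sum-++)
open import Data.Fin using (Fin; toℕ)
import Data.Fin as Fin
open import Data.Fin.Properties using (toℕ-injective)
open import Data.List using (List; []; _∷_; _++_; length; map; concat; tabulate; replicate; filter; applyUpTo)
open import Data.List.Properties using (filter-accept; filter-reject; map-++)
open import Data.List.Relation.Unary.All using (All; []; _∷_)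
open import Data.List.Relation.Unary.Linked using (Linked; [])
open import Data.List.Relation.Unary.Linked.Properties using (Linked⇒All)
open import Data.Bool using (if_then_else_)
open import Data.Sum using (inj₁; inj₂)
open import Function using (_∘_)
open import Relation.Nullary using (yes; no)
open import Relation.Nullary.Decidable using (⌊_⌋)
open import Relation.Binary.PropositionalEquality

⟦_≤_⟧ : ℕ → ℕ → ℕ
⟦ zero  ≤ n     ⟧ = 1
⟦ suc m ≤ zero  ⟧ = 0
⟦ suc m ≤ suc n ⟧ = ⟦ m ≤ n ⟧

⟦≤⟧-true : ∀ {m n} → m ≤ n → ⟦ m ≤ n ⟧ ≡ 1
⟦≤⟧-true z≤n     = refl
⟦≤⟧-true (s≤s p) = ⟦≤⟧-true p

⟦≤⟧-false : ∀ {m n} → n < m → ⟦ m ≤ n ⟧ ≡ 0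
⟦≤⟧-false {suc m} {zero}  _       = refl
⟦≤⟧-false {suc m} {suc n} (s≤s p) = ⟦≤⟧-false p

⟦≤⟧-complement : ∀ k n → ⟦ suc k ≤ n ⟧ + ⟦ n ≤ k ⟧ ≡ 1
⟦≤⟧-complement k       zero    = refl
⟦≤⟧-complement zero    (suc n) = refl
⟦≤⟧-complement (suc k) (suc n) = ⟦≤⟧-complement k n

⟦≤⟧-+ : ∀ t m n → ⟦ t + m ≤ n + t ⟧ ≡ ⟦ m ≤ n ⟧
⟦≤⟧-+ zero    m n = cong ⟦ m ≤_⟧ (+-identityʳ n)
⟦≤⟧-+ (suc t) m n = trans (cong ⟦ suc t + m ≤_⟧ (+-suc n t)) (⟦≤⟧-+ t m n)

∑ : List ℕ → (ℕ → ℕ) → ℕ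
∑ xs f = sum (map f xs)

syntax ∑ xs (λ x → e) = ∑[ x ∈ xs ] e

∑-cong : ∀ {f g} xs → (∀ x → f x ≡ g x) → ∑ xs f ≡ ∑ xs g
∑-cong []       f≗g = refl
∑-cong (x ∷ xs) f≗g = cong₂ _+_ (f≗g x) (∑-cong xs f≗g)

∑-congᴬ : ∀ {P : ℕ → Set} {f g xs} → All P xs → (∀ {x} → P x → f x ≡ g x) → ∑ xs f ≡ ∑ xs g
∑-congᴬ []         f≗g = refl
∑-congᴬ (px ∷ pxs) f≗g = cong₂ _+_ (f≗g px) (∑-congᴬ pxs f≗g)

+-interchange : ∀ a b c d → (a + b) + (c + d) ≡ (a + c) + (b + d)
+-interchange a b c d = begin
  (a + b) + (c + d)  ≡⟨ +-assoc a b (c + d) ⟩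
  a + (b + (c + d))  ≡⟨ cong (a +_) (+-comm b (c + d)) ⟩
  a + ((c + d) + b)  ≡⟨ cong (a +_) (+-assoc c d b) ⟩
  a + (c + (d + b))  ≡⟨ cong (λ z → a + (c + z)) (+-comm d b) ⟩
  a + (c + (b + d))  ≡⟨ +-assoc a c (b + d) ⟨
  (a + c) + (b + d)  ∎
  where open ≡-Reasoning

∑-distrib-+ : ∀ f g xs → ∑[ x ∈ xs ] (f x + g x) ≡ ∑ xs f + ∑ xs g
∑-distrib-+ f g []       = refl
∑-distrib-+ f g (x ∷ xs) =
  trans (cong (f x + g x +_) (∑-distrib-+ f g xs)) (+-interchange (f x) (g x) _ _)

∑-distribˡ-* : ∀ c f xs → c * ∑ xs f ≡ ∑[ x ∈ xs ] (c * f x)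
∑-distribˡ-* c f []       = *-zeroʳ c
∑-distribˡ-* c f (x ∷ xs) =
  trans (*-distribˡ-+ c (f x) _) (cong (c * f x +_) (∑-distribˡ-* c f xs))

∑-distribʳ-* : ∀ c f xs → ∑ xs f * c ≡ ∑[ x ∈ xs ] (f x * c)
∑-distribʳ-* c f xs = begin
  ∑ xs f * c             ≡⟨ *-comm (∑ xs f) c ⟩
  c * ∑ xs f             ≡⟨ ∑-distribˡ-* c f xs ⟩
  ∑[ x ∈ xs ] (c * f x)  ≡⟨ ∑-cong xs (λ x → *-comm c (f x)) ⟩
  ∑[ x ∈ xs ] (f x * c)  ∎
  where open ≡-Reasoning

∑-map : ∀ f g xs → ∑ (map g xs) f ≡ ∑[ x ∈ xs ] f (g x)
∑-map f g []       = refl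
∑-map f g (x ∷ xs) = cong (f (g x) +_) (∑-map f g xs)

∑-++ : ∀ f xs ys → ∑ (xs ++ ys) f ≡ ∑ xs f + ∑ ys f
∑-++ f xs ys = trans (cong sum (map-++ f xs ys)) (sum-++ (map f xs) (map f ys))

∑-replicate : ∀ f n x → ∑ (replicate n x) f ≡ n * f x
∑-replicate f zero    x = refl
∑-replicate f (suc n) x = cong (f x +_) (∑-replicate f n x)

∑-const-1 : ∀ xs → ∑[ x ∈ xs ] 1 ≡ length xs
∑-const-1 []       = refl
∑-const-1 (x ∷ xs) = cong suc (∑-const-1 xs)

∑< : ℕ → (ℕ → ℕ) → ℕ
∑< zero    f = 0
∑< (suc n) f = f 0 + ∑< n (f ∘ suc)

syntax ∑< n (λ k → e) = ∑[ k < n ] e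

∑-applyUpTo : ∀ f g n → ∑ (applyUpTo g n) f ≡ ∑[ k < n ] f (g k)
∑-applyUpTo f g zero    = refl
∑-applyUpTo f g (suc n) = cong (f (g 0) +_) (∑-applyUpTo f (g ∘ suc) n)

∑<-cong : ∀ n {f g} → (∀ k → f k ≡ g k) → ∑< n f ≡ ∑< n g
∑<-cong zero    f≗g = refl
∑<-cong (suc n) f≗g = cong₂ _+_ (f≗g 0) (∑<-cong n (f≗g ∘ suc))

∑<-zero : ∀ n f → (∀ {k} → k < n → f k ≡ 0) → ∑< n f ≡ 0
∑<-zero zero    f f≡0 = refl
∑<-zero (suc n) f f≡0 = cong₂ _+_ (f≡0 z<s) (∑<-zero n (f ∘ suc) (f≡0 ∘ s≤s))

∑<-+ : ∀ m n f → ∑< (m + n) f ≡ ∑< m f + ∑[ k < n ] f (m + k)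
∑<-+ zero    n f = refl
∑<-+ (suc m) n f = trans (cong (f 0 +_) (∑<-+ m n (f ∘ suc))) (sym (+-assoc (f 0) _ _))

∑<-distrib-+ : ∀ n f g → ∑[ k < n ] (f k + g k) ≡ ∑< n f + ∑< n g
∑<-distrib-+ zero    f g = refl
∑<-distrib-+ (suc n) f g =
  trans (cong (f 0 + g 0 +_) (∑<-distrib-+ n (f ∘ suc) (g ∘ suc))) (+-interchange (f 0) (g 0) _ _)

∑<-∑-comm : ∀ n (g : ℕ → ℕ → ℕ) xs → ∑[ k < n ] ∑ xs (g k) ≡ ∑[ x ∈ xs ] ∑[ k < n ] g k x
∑<-∑-comm n g []       = ∑<-zero n _ (λ _ → refl)
∑<-∑-comm n g (x ∷ xs) =
  trans (∑<-distrib-+ n (λ k → g k x) (λ k → ∑ xs (g k))) (cong (∑< n (λ k → g k x) +_) (∑<-∑-comm n g xs))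

∑<-window : ∀ n a b → a ≤ n → ∑[ k < n ] (⟦ 2 + k ≤ a ⟧ * ⟦ b ≤ k ⟧) ≡ a ∸ suc b
∑<-window zero    .zero          b       z≤n     = refl
∑<-window (suc n) zero           b       _       = ∑<-zero n _ (λ _ → refl)
∑<-window (suc n) (suc zero)     b       _       = trans (∑<-zero n _ (λ _ → refl)) (sym (0∸n≡0 b))
∑<-window (suc n) (suc (suc a))  zero    (s≤s p) = cong suc (∑<-window n (suc a) zero p)
∑<-window (suc n) (suc (suc a))  (suc b) (s≤s p) = ∑<-window n (suc a) b p

conj-∑ : ∀ xs j → conj xs j ≡ ∑[ x ∈ xs ] ⟦ j ≤ x ⟧
conj-∑ []       j = refl
conj-∑ (x ∷ xs) j with j ≤? x
... | yes j≤x = begin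
  length (filter (j ≤?_) (x ∷ xs))  ≡⟨ cong length (filter-accept (j ≤?_) j≤x) ⟩
  suc (conj xs j)                   ≡⟨ cong suc (conj-∑ xs j) ⟩
  1 + ∑[ y ∈ xs ] ⟦ j ≤ y ⟧          ≡⟨ cong (_+ _) (⟦≤⟧-true j≤x) ⟨
  ⟦ j ≤ x ⟧ + ∑[ y ∈ xs ] ⟦ j ≤ y ⟧  ∎
  where open ≡-Reasoning
... | no j≰x = begin
  length (filter (j ≤?_) (x ∷ xs))  ≡⟨ cong length (filter-reject (j ≤?_) j≰x) ⟩
  conj xs j                         ≡⟨ conj-∑ xs j ⟩
  ∑[ y ∈ xs ] ⟦ j ≤ y ⟧              ≡⟨ cong (_+ _) (⟦≤⟧-false (≰⇒> j≰x)) ⟨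
  ⟦ j ≤ x ⟧ + ∑[ y ∈ xs ] ⟦ j ≤ y ⟧  ∎
  where open ≡-Reasoning

conj-+-full : ∀ t xs {j} → j ≤ t → conj (map (_+ t) xs) j ≡ length xs
conj-+-full t xs {j} j≤t = begin
  conj (map (_+ t) xs) j        ≡⟨ conj-∑ (map (_+ t) xs) j ⟩
  ∑ (map (_+ t) xs) ⟦ j ≤_⟧     ≡⟨ ∑-map ⟦ j ≤_⟧ (_+ t) xs ⟩
  ∑[ x ∈ xs ] ⟦ j ≤ x + t ⟧     ≡⟨ ∑-cong xs (λ x → ⟦≤⟧-true (≤-trans j≤t (m≤n+m t x))) ⟩
  ∑[ x ∈ xs ] 1                 ≡⟨ ∑-const-1 xs ⟩
  length xs                     ∎
  where open ≡-Reasoning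

conj-+ : ∀ t xs m → conj (map (_+ t) xs) (t + m) ≡ conj xs m
conj-+ t xs m = begin
  conj (map (_+ t) xs) (t + m)   ≡⟨ conj-∑ (map (_+ t) xs) (t + m) ⟩
  ∑ (map (_+ t) xs) ⟦ t + m ≤_⟧  ≡⟨ ∑-map ⟦ t + m ≤_⟧ (_+ t) xs ⟩
  ∑[ x ∈ xs ] ⟦ t + m ≤ x + t ⟧  ≡⟨ ∑-cong xs (⟦≤⟧-+ t m) ⟩
  ∑[ x ∈ xs ] ⟦ m ≤ x ⟧          ≡⟨ conj-∑ xs m ⟨
  conj xs m                      ∎
  where open ≡-Reasoning

length∸conj : ∀ xs k → length xs ∸ conj xs (suc k) ≡ ∑[ x ∈ xs ] ⟦ x ≤ k ⟧
length∸conj xs k = begin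
  length xs ∸ A                  ≡⟨ cong (_∸ A) (∑-const-1 xs) ⟨
  ∑[ x ∈ xs ] 1 ∸ A              ≡⟨ cong (_∸ A) (∑-cong xs (λ x → sym (⟦≤⟧-complement k x))) ⟩
  ∑[ x ∈ xs ] (⟦ suc k ≤ x ⟧ + ⟦ x ≤ k ⟧) ∸ A
                                 ≡⟨ cong (_∸ A) (∑-distrib-+ ⟦ suc k ≤_⟧ ⟦_≤ k ⟧ xs) ⟩
  ∑ xs ⟦ suc k ≤_⟧ + ∑ xs ⟦_≤ k ⟧ ∸ A
                                 ≡⟨ cong (λ z → z + ∑ xs ⟦_≤ k ⟧ ∸ A) (conj-∑ xs (suc k)) ⟨
  A + ∑ xs ⟦_≤ k ⟧ ∸ A           ≡⟨ m+n∸m≡n A _ ⟩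
  ∑[ x ∈ xs ] ⟦ x ≤ k ⟧          ∎
  where open ≡-Reasoning
        A = conj xs (suc k)

gapSum : List ℕ → ℕ
gapSum xs = ∑[ a ∈ xs ] ∑[ b ∈ xs ] (a ∸ suc b)

conjTerm : ℕ → List ℕ → ℕ → ℕ
conjTerm t xs j = (conj (map (_+ t) xs) 1 ∸ conj (map (_+ t) xs) j) * conj (map (_+ t) xs) (suc j)

conjTerm-full : ∀ t xs {j} → 1 ≤ t → j ≤ t → conjTerm t xs j ≡ 0
conjTerm-full t xs {j} 1≤t j≤t =
  cong (_* conj (map (_+ t) xs) (suc j)) (trans (cong₂ _∸_ (conj-+-full t xs 1≤t) (conj-+-full t xs j≤t)) (n∸n≡0 (length xs)))

conjTerm-+ : ∀ t xs k → 1 ≤ t →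
  conjTerm t xs (suc (t + k)) ≡ ∑[ a ∈ xs ] ∑[ b ∈ xs ] (⟦ 2 + k ≤ a ⟧ * ⟦ b ≤ k ⟧)
conjTerm-+ t xs k 1≤t = begin
  (C 1 ∸ C (suc (t + k))) * C (suc (suc (t + k)))
    ≡⟨ cong₂ (λ u v → (C 1 ∸ C u) * C v) (sym (+-suc t k)) (sym (trans (+-suc t (suc k)) (cong suc (+-suc t k)))) ⟩
  (C 1 ∸ C (t + suc k)) * C (t + suc (suc k))
    ≡⟨ cong₂ (λ u v → (u ∸ v) * C (t + suc (suc k))) (conj-+-full t xs 1≤t) (conj-+ t xs (suc k)) ⟩
  (length xs ∸ conj xs (suc k)) * C (t + suc (suc k))
    ≡⟨ cong₂ _*_ (length∸conj xs k) (trans (conj-+ t xs (2 + k)) (conj-∑ xs (2 + k))) ⟩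
  ∑ xs ⟦_≤ k ⟧ * ∑ xs ⟦ 2 + k ≤_⟧
    ≡⟨ *-comm (∑ xs ⟦_≤ k ⟧) _ ⟩
  ∑ xs ⟦ 2 + k ≤_⟧ * ∑ xs ⟦_≤ k ⟧
    ≡⟨ ∑-distribʳ-* _ ⟦ 2 + k ≤_⟧ xs ⟩
  ∑[ a ∈ xs ] (⟦ 2 + k ≤ a ⟧ * ∑ xs ⟦_≤ k ⟧)
    ≡⟨ ∑-cong xs (λ a → ∑-distribˡ-* ⟦ 2 + k ≤ a ⟧ ⟦_≤ k ⟧ xs) ⟩
  ∑[ a ∈ xs ] ∑[ b ∈ xs ] (⟦ 2 + k ≤ a ⟧ * ⟦ b ≤ k ⟧)
    ∎
  where open ≡-Reasoning
        C = conj (map (_+ t) xs)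

conjSum≡gapSum : ∀ t n xs → 1 ≤ t → All (_≤ n) xs → Σ1to (n + t) (conjTerm t xs) ≡ gapSum xs
conjSum≡gapSum t n xs 1≤t xs≤n = begin
  Σ1to (n + t) f
    ≡⟨ ∑-applyUpTo (f ∘ suc) (λ k → k) (n + t) ⟩
  ∑[ k < n + t ] f (suc k)
    ≡⟨ cong (λ m → ∑< m (f ∘ suc)) (+-comm n t) ⟩
  ∑[ k < t + n ] f (suc k)
    ≡⟨ ∑<-+ t n (f ∘ suc) ⟩
  ∑[ k < t ] f (suc k) + ∑[ k < n ] f (suc (t + k))
    ≡⟨ cong (_+ ∑[ k < n ] f (suc (t + k))) (∑<-zero t (f ∘ suc) (conjTerm-full t xs 1≤t)) ⟩
  ∑[ k < n ] f (suc (t + k))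
    ≡⟨ ∑<-cong n (λ k → conjTerm-+ t xs k 1≤t) ⟩
  ∑[ k < n ] ∑[ a ∈ xs ] ∑[ b ∈ xs ] (⟦ 2 + k ≤ a ⟧ * ⟦ b ≤ k ⟧)
    ≡⟨ ∑<-∑-comm n (λ k a → ∑[ b ∈ xs ] (⟦ 2 + k ≤ a ⟧ * ⟦ b ≤ k ⟧)) xs ⟩
  ∑[ a ∈ xs ] ∑[ k < n ] ∑[ b ∈ xs ] (⟦ 2 + k ≤ a ⟧ * ⟦ b ≤ k ⟧)
    ≡⟨ ∑-cong xs (λ a → ∑<-∑-comm n (λ k b → ⟦ 2 + k ≤ a ⟧ * ⟦ b ≤ k ⟧) xs) ⟩
  ∑[ a ∈ xs ] ∑[ b ∈ xs ] ∑[ k < n ] (⟦ 2 + k ≤ a ⟧ * ⟦ b ≤ k ⟧)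
    ≡⟨ ∑-congᴬ xs≤n (λ {a} a≤n → ∑-cong xs (λ b → ∑<-window n a b a≤n)) ⟩
  gapSum xs
    ∎
  where open ≡-Reasoning
        f = conjTerm t xs

ΣFin-cong : ∀ n {f g : Fin n → ℕ} → (∀ i → f i ≡ g i) → Σ[ n ] f ≡ Σ[ n ] g
ΣFin-cong zero    f≗g = refl
ΣFin-cong (suc n) f≗g = cong₂ _+_ (f≗g Fin.zero) (ΣFin-cong n (f≗g ∘ Fin.suc))

ΣFin-distribˡ-* : ∀ n c (f : Fin n → ℕ) → c * Σ[ n ] f ≡ Σ[ n ] (λ i → c * f i)
ΣFin-distribˡ-* zero    c f = *-zeroʳ c
ΣFin-distribˡ-* (suc n) c f =
  trans (*-distribˡ-+ c (f Fin.zero) _) (cong (c * f Fin.zero +_) (ΣFin-distribˡ-* n c (f ∘ Fin.suc)))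

∑-concat-replicate : ∀ l (μ ρ : Fin l → ℕ) h →
  ∑ (concat (tabulate (λ i → replicate (ρ i) (μ i)))) h ≡ Σ[ l ] (λ i → ρ i * h (μ i))
∑-concat-replicate zero    μ ρ h = refl
∑-concat-replicate (suc l) μ ρ h =
  trans (∑-++ h (replicate (ρ Fin.zero) (μ Fin.zero)) _)
        (cong₂ _+_ (∑-replicate h (ρ Fin.zero) (μ Fin.zero)) (∑-concat-replicate l (μ ∘ Fin.suc) (ρ ∘ Fin.suc) h))

StrictlyDecreasing : ∀ {l} → (Fin l → ℕ) → Set
StrictlyDecreasing μ = ∀ i j → toℕ i < toℕ j → μ j < μ i

StrictlyDecreasing⇒antitone : ∀ {l} {μ : Fin l → ℕ} → StrictlyDecreasing μ →
  ∀ i j → toℕ j ≤ toℕ i → μ i ≤ μ j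
StrictlyDecreasing⇒antitone μ↓ i j j≤i with m≤n⇒m<n∨m≡n j≤i
... | inj₁ j<i = <⇒≤ (μ↓ j i j<i)
... | inj₂ j≡i = ≤-reflexive (cong _ (toℕ-injective (sym j≡i)))

pairTerm : ∀ {l} (μ ρ : Fin l → ℕ) → StrictlyDecreasing μ → ∀ i j →
  (if ⌊ toℕ i <? toℕ j ⌋ then ((μ i ∸ μ j) ∸ 1) * ρ i * ρ j else 0) ≡ ρ i * (ρ j * (μ i ∸ suc (μ j)))
pairTerm μ ρ μ↓ i j with toℕ i <? toℕ j
... | yes _ = begin
  ((μ i ∸ μ j) ∸ 1) * ρ i * ρ j   ≡⟨ cong (λ d → d * ρ i * ρ j) (∸-+-assoc (μ i) (μ j) 1) ⟩
  (μ i ∸ (μ j + 1)) * ρ i * ρ j   ≡⟨ cong (λ d → (μ i ∸ d) * ρ i * ρ j) (+-comm (μ j) 1) ⟩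
  d * ρ i * ρ j                   ≡⟨ cong (_* ρ j) (*-comm d (ρ i)) ⟩
  ρ i * d * ρ j                   ≡⟨ *-assoc (ρ i) d (ρ j) ⟩
  ρ i * (d * ρ j)                 ≡⟨ cong (ρ i *_) (*-comm d (ρ j)) ⟩
  ρ i * (ρ j * d)                 ∎
  where open ≡-Reasoning
        d = μ i ∸ suc (μ j)
... | no i≮j = sym (begin
  ρ i * (ρ j * (μ i ∸ suc (μ j)))  ≡⟨ cong (λ d → ρ i * (ρ j * d)) (m≤n⇒m∸n≡0 (m≤n⇒m≤1+n μi≤μj)) ⟩
  ρ i * (ρ j * 0)                  ≡⟨ cong (ρ i *_) (*-zeroʳ (ρ j)) ⟩
  ρ i * 0                          ≡⟨ *-zeroʳ (ρ i) ⟩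
  0                                ∎)
  where open ≡-Reasoning
        μi≤μj = StrictlyDecreasing⇒antitone μ↓ i j (≮⇒≥ i≮j)

Σpairs≡gapSum : ∀ l (μ ρ : Fin l → ℕ) → StrictlyDecreasing μ →
  Σpairs l (λ i j → ((μ i ∸ μ j) ∸ 1) * ρ i * ρ j) ≡ gapSum (concat (tabulate (λ i → replicate (ρ i) (μ i))))
Σpairs≡gapSum l μ ρ μ↓ = begin
  Σpairs l (λ i j → ((μ i ∸ μ j) ∸ 1) * ρ i * ρ j)
    ≡⟨ ΣFin-cong l (λ i → trans (ΣFin-cong l (pairTerm μ ρ μ↓ i)) (sym (ΣFin-distribˡ-* l (ρ i) _))) ⟩
  Σ[ l ] (λ i → ρ i * Σ[ l ] (λ j → ρ j * (μ i ∸ suc (μ j))))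
    ≡⟨ ΣFin-cong l (λ i → cong (ρ i *_) (∑-concat-replicate l μ ρ (λ b → μ i ∸ suc b))) ⟨
  Σ[ l ] (λ i → ρ i * ∑[ b ∈ xs ] (μ i ∸ suc b))
    ≡⟨ ∑-concat-replicate l μ ρ (λ a → ∑[ b ∈ xs ] (a ∸ suc b)) ⟨
  gapSum xs
    ∎
  where open ≡-Reasoning
        xs = concat (tabulate (λ i → replicate (ρ i) (μ i)))

All≤head0 : ∀ xs → Linked _≥_ xs → All (_≤ head0 xs) xs
All≤head0 []       _    = []
All≤head0 (x ∷ xs) x∷xs↓ = Linked⇒All (λ p q → ≤-trans q p) ≤-refl x∷xs↓

lemma2p3 : (s r : ℕ) → 1 ≤ s → (lam : List ℕ) → length lam ≡ s → Linked _≥_ lam → sum lam ≡ r →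
           (l : ℕ) (μ ρ : Fin l → ℕ) →
           (∀ (i j : Fin l) → toℕ i < toℕ j → μ j < μ i) →
           (∀ (i : Fin l) → 1 ≤ ρ i) →
           lam ≡ concat (tabulate (λ i → replicate (ρ i) (μ i))) →
           (t : ℕ) → 1 ≤ t →
           Σpairs l (λ i j → ((μ i ∸ μ j) ∸ 1) * ρ i * ρ j)
             ≡ Σ1to (head0 lam + t)
                 (λ j → (conj (map (_+ t) lam) 1 ∸ conj (map (_+ t) lam) j) * conj (map (_+ t) lam) (suc j))
lemma2p3 s r _ lam _ lam↓ _ l μ ρ μ↓ _ lam≡ t 1≤t = begin
  Σpairs l (λ i j → ((μ i ∸ μ j) ∸ 1) * ρ i * ρ j)  ≡⟨ Σpairs≡gapSum l μ ρ μ↓ ⟩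
  gapSum (concat (tabulate (λ i → replicate (ρ i) (μ i))))  ≡⟨ cong gapSum lam≡ ⟨
  gapSum lam                                        ≡⟨ conjSum≡gapSum t (head0 lam) lam 1≤t (All≤head0 lam lam↓) ⟨
  Σ1to (head0 lam + t) (conjTerm t lam)             ∎
  where open ≡-Reasoning
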